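{- Let $1 \leq \ell < n$ be integers. Then $\mathcal{O}_{\ell+1}^{\ell} \,|\, \mathcal{O}_n^{\ell}$; that is, the $\ell$-skeleton of the $n$-dimensional cross-polytope is the union of subcomplexes, each isomorphic to the $\ell$-skeleton of the $(\ell+1)$-dimensional cross-polytope, such that every $\ell$-face of $\mathcal{O}_n^\ell$ lies in exactly one of these subcomplexes.
   Context: $\mathcal{O}_n$ denotes the $n$-dimensional cross-polytope (whose 1-skeleton is the graph $K_{2n}$ minus a perfect matching). For a polytope $A$ and integer $k\ge 0$, $A^k$ denotes its $k$-skeleton (the polytopal complex of all faces of dimension at most $k$). For polytopal $\ell$-complexes $L$ and $K$, $L \,|\, K$ ("$L$ factors $K$") means that $K$ and $L$ both have dimension $\ell$ and $K$ is the union of subcomplexes $L_1,\dots,L_r$, each isomorphic to $L$, such that every $\ell$-face of $K$ is contained in exactly one $L_i$. Note $\mathcal{O}_{\ell+1}^\ell$ is the boundary complex of $\mathcal{O}_{\ell+1}$. -}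

module Defs where

open import Data.Nat using (ℕ; zero; suc; _+_; _≤_)
open import Data.Fin using (Fin)
import Data.Fin as F
open import Data.Bool using (Bool; true; false; if_then_else_)
open import Data.Product using (Σ; _×_; _,_; ∃)
open import Relation.Binary.PropositionalEquality using (_≡_)
open import Relation.Nullary using (¬_)
open import Function.Definitions using (Injective)
open import Function.Bundles using (_⇔_)

-- Vertices of the n-dimensional cross-polytope O_n: the points ±e_i,
-- encoded as (i , true) = +e_i and (i , false) = -e_i.
Vtx : ℕ → Set
Vtx n = Fin n × Bool

VSet : ℕ → Set
VSet n = Vtx n → Bool

b2n : Bool → ℕ
b2n true  = 1
b2n false = 0

card : {n : ℕ} → VSet n → ℕ
card {zero}  S = 0
card {suc n} S = b2n (S (F.zero , true)) + b2n (S (F.zero , false))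
               + card {n} (λ v → S (F.suc (Data.Product.proj₁ v) , Data.Product.proj₂ v))

NoAntipodal : {n : ℕ} → VSet n → Set
NoAntipodal {n} S = (i : Fin n) → ¬ ((S (i , true) ≡ true) × (S (i , false) ≡ true))

-- S (as a vertex set) is a face of the k-skeleton O_n^k, for k < n:
-- the proper faces of O_n are exactly the convex hulls of vertex sets with
-- no antipodal pair; such a face with j vertices has dimension j - 1.
-- (The empty face is included.)  Only used with k < n.
IsSkelFace : (n k : ℕ) → VSet n → Set
IsSkelFace n k S = NoAntipodal S × (card S ≤ suc k)

IsTopFace : (n k : ℕ) → VSet n → Set
IsTopFace n k S = NoAntipodal S × (card S ≡ suc k)

ImageOf : {m n : ℕ} → (Vtx m → Vtx n) → VSet m → VSet n → Set
ImageOf {m} {n} φ G F = (v : Vtx n) → (F v ≡ true) ⇔ (∃ λ (u : Vtx m) → (G u ≡ true) × (φ u ≡ v))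

-- The subcomplex L_φ is the image of O_m^k, which is isomorphic to O_m^k via φ.
IsSkelEmbedding : (k m n : ℕ) → (Vtx m → Vtx n) → Set
IsSkelEmbedding k m n φ =
  Injective _≡_ _≡_ φ ×
  ((G : VSet m) → IsSkelFace m k G → ∃ λ (F : VSet n) → IsSkelFace n k F × ImageOf φ G F)

InCopy : (k m n : ℕ) → (Vtx m → Vtx n) → VSet n → Set
InCopy k m n φ F = ∃ λ (G : VSet m) → IsSkelFace m k G × ImageOf φ G F

Factors : (ℓ n : ℕ) → Set
Factors ℓ n =
  Σ ℕ λ r → Σ (Fin r → Vtx (suc ℓ) → Vtx n) λ φ →
    ((i : Fin r) → IsSkelEmbedding ℓ (suc ℓ) n (φ i)) ×
    ((F : VSet n) → IsTopFace n ℓ F →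
       Σ (Fin r) λ i → InCopy ℓ (suc ℓ) n (φ i) F ×
         ((j : Fin r) → InCopy ℓ (suc ℓ) n (φ j) F → j ≡ i))

{-# OPTIONS --safe #-}
module Submission where

-- An ℓ-face of O_n is a set of ℓ+1 vertices ±e_j with pairwise distinct coordinates j, so it
-- determines an (ℓ+1)-set J of coordinates.  For every (ℓ+1)-set J take the copy of O_{ℓ+1}^ℓ
-- spanned by the vertices ±e_j, j ∈ J.  A face lies in the copy for J iff its coordinates lie in
-- J, and as both sets have ℓ+1 elements this happens for its own J only.

open import Defs
open import Data.Nat using (ℕ; zero; suc; _+_; _≤_; _<_; z≤n; s≤s)
open import Data.Nat.Properties using (m≤n⇒m≤1+n; 1+n≰n; ≤-reflexive)
open import Data.Fin using (Fin; splitAt; _↑ˡ_; _↑ʳ_)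
import Data.Fin as F
open import Data.Fin.Properties
  using (suc-injective; splitAt-↑ˡ; splitAt-↑ʳ; splitAt⁻¹-↑ˡ; splitAt⁻¹-↑ʳ)
open import Data.Bool using (Bool; true; false; _∨_)
open import Data.Bool.Properties using (∨-zeroʳ)
open import Data.Product using (Σ; _×_; _,_; ∃; proj₁; proj₂)
open import Data.Sum using (inj₁; inj₂)
open import Data.Empty using (⊥-elim)
open import Relation.Nullary using (¬_)
open import Relation.Binary.PropositionalEquality
open import Function.Bundles using (mk⇔; Equivalence)

variable
  n k m : ℕ

data Choose : ℕ → ℕ → Set where
  done : Choose 0 0
  take : Choose n k → Choose (suc n) (suc k)
  skip : Choose n k → Choose (suc n) k

index : Choose n k → Fin k → Fin n
index (take c) F.zero    = F.zero
index (take c) (F.suc i) = F.suc (index c i)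
index (skip c) i         = F.suc (index c i)

index-injective : (c : Choose n k) {i i′ : Fin k} → index c i ≡ index c i′ → i ≡ i′
index-injective (take c) {F.zero}  {F.zero}   e = refl
index-injective (take c) {F.suc i} {F.suc i′} e = cong F.suc (index-injective c (suc-injective e))
index-injective (skip c) e = index-injective c (suc-injective e)

_∈_ : Fin n → Choose n k → Set
j ∈ c = ∃ λ i → index c i ≡ j

_⊆_ : Choose n k → Choose n m → Set
c ⊆ d = ∀ {j} → j ∈ c → j ∈ d

module _ {c : Choose n k} where

  zero∈take : F.zero ∈ take c
  zero∈take = F.zero , refl

  zero∉skip : ¬ (F.zero ∈ skip c)
  zero∉skip (_ , ())

  ∈-take⁺ : {j : Fin n} → j ∈ c → F.suc j ∈ take c
  ∈-take⁺ (i , e) = F.suc i , cong F.suc e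

  ∈-take⁻ : {j : Fin n} → F.suc j ∈ take c → j ∈ c
  ∈-take⁻ (F.suc i , e) = i , suc-injective e

  ∈-skip⁺ : {j : Fin n} → j ∈ c → F.suc j ∈ skip c
  ∈-skip⁺ (i , e) = i , cong F.suc e

  ∈-skip⁻ : {j : Fin n} → F.suc j ∈ skip c → j ∈ c
  ∈-skip⁻ (i , e) = i , suc-injective e

module _ {c : Choose n k} {d : Choose n m} where

  take⊆take⁻ : take c ⊆ take d → c ⊆ d
  take⊆take⁻ c⊆d j∈c = ∈-take⁻ (c⊆d (∈-take⁺ j∈c))

  take⊈skip : ¬ (take c ⊆ skip d)
  take⊈skip c⊆d = zero∉skip (c⊆d zero∈take)

  skip⊆take⁻ : skip c ⊆ take d → c ⊆ d
  skip⊆take⁻ c⊆d j∈c = ∈-take⁻ (c⊆d (∈-skip⁺ j∈c))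

  skip⊆skip⁻ : skip c ⊆ skip d → c ⊆ d
  skip⊆skip⁻ c⊆d j∈c = ∈-skip⁻ (c⊆d (∈-skip⁺ j∈c))

⊆⇒≤ : (c : Choose n k) (d : Choose n m) → c ⊆ d → k ≤ m
⊆⇒≤ done     done     c⊆d = z≤n
⊆⇒≤ (take c) (take d) c⊆d = s≤s (⊆⇒≤ c d (take⊆take⁻ c⊆d))
⊆⇒≤ (take c) (skip d) c⊆d = ⊥-elim (take⊈skip c⊆d)
⊆⇒≤ (skip c) (take d) c⊆d = m≤n⇒m≤1+n (⊆⇒≤ c d (skip⊆take⁻ c⊆d))
⊆⇒≤ (skip c) (skip d) c⊆d = ⊆⇒≤ c d (skip⊆skip⁻ c⊆d)

⊆⇒≡ : (c d : Choose n k) → c ⊆ d → c ≡ d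
⊆⇒≡ done     done     c⊆d = refl
⊆⇒≡ (take c) (take d) c⊆d = cong take (⊆⇒≡ c d (take⊆take⁻ c⊆d))
⊆⇒≡ (take c) (skip d) c⊆d = ⊥-elim (take⊈skip c⊆d)
⊆⇒≡ (skip c) (take d) c⊆d = ⊥-elim (1+n≰n (⊆⇒≤ c d (skip⊆take⁻ c⊆d)))
⊆⇒≡ (skip c) (skip d) c⊆d = cong skip (⊆⇒≡ c d (skip⊆skip⁻ c⊆d))

C : ℕ → ℕ → ℕ
C zero    zero    = 1
C zero    (suc k) = 0
C (suc n) zero    = C n zero
C (suc n) (suc k) = C n k + C n (suc k)

fromFin : Fin (C n k) → Choose n k
fromFin {zero}  {zero}  _ = done
fromFin {suc n} {zero}  i = skip (fromFin i)
fromFin {suc n} {suc k} i with splitAt (C n k) i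
... | inj₁ i′ = take (fromFin i′)
... | inj₂ i′ = skip (fromFin i′)

toFin : Choose n k → Fin (C n k)
toFin done = F.zero
toFin {suc n} {suc k} (take c) = toFin c ↑ˡ C n (suc k)
toFin {suc n} {zero}  (skip c) = toFin c
toFin {suc n} {suc k} (skip c) = C n k ↑ʳ toFin c

toFin-fromFin : (i : Fin (C n k)) → toFin (fromFin {n} {k} i) ≡ i
toFin-fromFin {zero}  {zero}  F.zero = refl
toFin-fromFin {suc n} {zero}  i = toFin-fromFin {n} i
toFin-fromFin {suc n} {suc k} i with splitAt (C n k) i in eq
... | inj₁ i′ = trans (cong (_↑ˡ C n (suc k)) (toFin-fromFin {n} i′)) (splitAt⁻¹-↑ˡ eq)
... | inj₂ i′ = trans (cong (C n k ↑ʳ_) (toFin-fromFin {n} i′)) (splitAt⁻¹-↑ʳ eq)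

fromFin-toFin : (c : Choose n k) → fromFin (toFin c) ≡ c
fromFin-toFin done = refl
fromFin-toFin {suc n} {suc k} (take c)
  rewrite splitAt-↑ˡ (C n k) (toFin c) (C n (suc k)) = cong take (fromFin-toFin c)
fromFin-toFin {suc n} {zero}  (skip c) = cong skip (fromFin-toFin c)
fromFin-toFin {suc n} {suc k} (skip c)
  rewrite splitAt-↑ʳ (C n k) (C n (suc k)) (toFin c) = cong skip (fromFin-toFin c)

tailV : VSet (suc n) → VSet n
tailV S (j , b) = S (F.suc j , b)

embed : Choose n k → Vtx k → Vtx n
embed c (i , b) = index c i , b

embed-injective : (c : Choose n k) {u v : Vtx k} → embed c u ≡ embed c v → u ≡ v
embed-injective c {i , b} {i′ , b′} e = cong₂ _,_ (index-injective c (cong proj₁ e)) (cong proj₂ e)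

push : Choose n k → VSet k → VSet n
push (take c) G (F.zero  , b) = G (F.zero , b)
push (take c) G (F.suc j , b) = push c (tailV G) (j , b)
push (skip c) G (F.zero  , b) = false
push (skip c) G (F.suc j , b) = push c G (j , b)

push-index : (c : Choose n k) (G : VSet k) (i : Fin k) (b : Bool) → push c G (index c i , b) ≡ G (i , b)
push-index (take c) G F.zero    b = refl
push-index (take c) G (F.suc i) b = push-index c (tailV G) i b
push-index (skip c) G i         b = push-index c G i b

push-support : (c : Choose n k) (G : VSet k) {j : Fin n} {b : Bool} → push c G (j , b) ≡ true → j ∈ c
push-support (take c) G {F.zero}  e = zero∈take
push-support (take c) G {F.suc j} e = ∈-take⁺ (push-support c (tailV G) e)
push-support (skip c) G {F.suc j} e = ∈-skip⁺ (push-support c G e)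

card-push : (c : Choose n k) (G : VSet k) → card (push c G) ≡ card G
card-push done     G = refl
card-push (take c) G =
  cong (b2n (G (F.zero , true)) + b2n (G (F.zero , false)) +_) (card-push c (tailV G))
card-push (skip c) G = card-push c G

pull : Choose n k → VSet n → VSet k
pull c S (i , b) = S (index c i , b)

SupportedOn : Choose n k → VSet n → Set
SupportedOn {n} c S = ∀ {j : Fin n} {b} → S (j , b) ≡ true → j ∈ c

card-pull : (c : Choose n k) (S : VSet n) → SupportedOn c S → card (pull c S) ≡ card S
card-pull done     S sup = refl
card-pull (take c) S sup =
  cong (b2n (S (F.zero , true)) + b2n (S (F.zero , false)) +_)
       (card-pull c (tailV S) (λ e → ∈-take⁻ (sup e)))
card-pull (skip c) S sup =
  trans (card-pull c (tailV S) (λ e → ∈-skip⁻ (sup e)))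
        (cong₂ (λ x y → b2n x + b2n y + card (tailV S)) (sym (outside true)) (sym (outside false)))
  where
  outside : ∀ b → S (F.zero , b) ≡ false
  outside b with S (F.zero , b) in e
  ... | true  = ⊥-elim (zero∉skip (sup e))
  ... | false = refl

image-push : (c : Choose n k) (G : VSet k) → ImageOf (embed c) G (push c G)
image-push c G (j , b) = mk⇔ to from
  where
  to : push c G (j , b) ≡ true → ∃ λ u → (G u ≡ true) × (embed c u ≡ (j , b))
  to e with push-support c G e
  ... | i , refl = (i , b) , trans (sym (push-index c G i b)) e , refl
  from : (∃ λ u → (G u ≡ true) × (embed c u ≡ (j , b))) → push c G (j , b) ≡ true
  from ((i , b) , g , refl) = trans (push-index c G i b) g

noAntipodal-push : (c : Choose n k) (G : VSet k) → NoAntipodal G → NoAntipodal (push c G)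
noAntipodal-push c G na j (e₊ , e₋) with push-support c G e₊
... | i , refl = na i (trans (sym (push-index c G i true)) e₊ , trans (sym (push-index c G i false)) e₋)

embed-isSkelEmbedding : (ℓ : ℕ) (c : Choose n k) → IsSkelEmbedding ℓ k n (embed c)
embed-isSkelEmbedding ℓ c = embed-injective c , λ G (na , G≤) →
  push c G , (noAntipodal-push c G na , subst (_≤ suc ℓ) (sym (card-push c G)) G≤) , image-push c G

image-pull : (c : Choose n k) (S : VSet n) → SupportedOn c S → ImageOf (embed c) (pull c S) S
image-pull c S sup (j , b) = mk⇔ to from
  where
  to : S (j , b) ≡ true → ∃ λ u → (pull c S u ≡ true) × (embed c u ≡ (j , b))
  to e with sup e
  ... | i , refl = (i , b) , e , refl
  from : (∃ λ u → (pull c S u ≡ true) × (embed c u ≡ (j , b))) → S (j , b) ≡ true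
  from ((i , b) , s , refl) = s

supportedOn⇒inCopy : (ℓ : ℕ) (c : Choose n k) (S : VSet n) → IsSkelFace n ℓ S → SupportedOn c S →
                     InCopy ℓ k n (embed c) S
supportedOn⇒inCopy ℓ c S (na , S≤) sup =
  pull c S , ((λ i → na (index c i)) , subst (_≤ suc ℓ) (sym (card-pull c S sup)) S≤) , image-pull c S sup

inCopy⇒supportedOn : (ℓ : ℕ) (c : Choose n k) (S : VSet n) → InCopy ℓ k n (embed c) S → SupportedOn c S
inCopy⇒supportedOn ℓ c S (G , _ , img) {j} {b} e with Equivalence.to (img (j , b)) e
... | (i , _) , _ , refl = i , refl

count : (Fin n → Bool) → ℕ
count {zero}  p = 0
count {suc n} p = b2n (p F.zero) + count (λ j → p (F.suc j))

cons : (b : Bool) → Choose n k → Choose (suc n) (b2n b + k)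
cons true  = take
cons false = skip

select : (p : Fin n → Bool) → Choose n (count p)
select {zero}  p = done
select {suc n} p = cons (p F.zero) (select (λ j → p (F.suc j)))

∈-select⁺ : (p : Fin n → Bool) {j : Fin n} → p j ≡ true → j ∈ select p
∈-select⁺ p {F.zero} e rewrite e = zero∈take
∈-select⁺ p {F.suc j} e with p F.zero
... | true  = ∈-take⁺ (∈-select⁺ (λ j → p (F.suc j)) e)
... | false = ∈-skip⁺ (∈-select⁺ (λ j → p (F.suc j)) e)

∈-select⁻ : (p : Fin n → Bool) {j : Fin n} → j ∈ select p → p j ≡ true
∈-select⁻ p {F.zero} j∈ with p F.zero
... | true  = refl
... | false = ⊥-elim (zero∉skip j∈)
∈-select⁻ p {F.suc j} j∈ with p F.zero
... | true  = ∈-select⁻ (λ j → p (F.suc j)) (∈-take⁻ j∈)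
... | false = ∈-select⁻ (λ j → p (F.suc j)) (∈-skip⁻ j∈)

occupied : VSet n → Fin n → Bool
occupied S j = S (j , true) ∨ S (j , false)

occupied⁺ : (S : VSet n) {j : Fin n} (b : Bool) → S (j , b) ≡ true → occupied S j ≡ true
occupied⁺ S {j} true  e = cong (_∨ S (j , false)) e
occupied⁺ S {j} false e = trans (cong (S (j , true) ∨_) e) (∨-zeroʳ (S (j , true)))

occupied⁻ : (S : VSet n) {j : Fin n} → occupied S j ≡ true → ∃ λ b → S (j , b) ≡ true
occupied⁻ S {j} e with S (j , true) in e₊
... | true  = true , e₊
... | false = false , e

b2n-∨ : (x y : Bool) → ¬ ((x ≡ true) × (y ≡ true)) → b2n (x ∨ y) ≡ b2n x + b2n y
b2n-∨ true  true  both = ⊥-elim (both (refl , refl))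
b2n-∨ true  false _    = refl
b2n-∨ false y     _    = refl

count-occupied : (S : VSet n) → NoAntipodal S → count (occupied S) ≡ card S
count-occupied {zero}  S na = refl
count-occupied {suc n} S na =
  cong₂ _+_ (b2n-∨ (S (F.zero , true)) (S (F.zero , false)) (na F.zero))
            (count-occupied (tailV S) (λ j → na (F.suc j)))

supportedOn-select : (S : VSet n) → SupportedOn (select (occupied S)) S
supportedOn-select S {b = b} e = ∈-select⁺ (occupied S) (occupied⁺ S b e)

select⊆ : (S : VSet n) (c : Choose n k) → SupportedOn c S → select (occupied S) ⊆ c
select⊆ S c sup j∈ = sup (proj₂ (occupied⁻ S (∈-select⁻ (occupied S) j∈)))

InExactlyOneCopy : (ℓ : ℕ) → VSet n → ℕ → Set
InExactlyOneCopy {n} ℓ S k =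
  Σ (Fin (C n k)) λ i → InCopy ℓ k n (embed (fromFin i)) S ×
    ((j : Fin (C n k)) → InCopy ℓ k n (embed (fromFin j)) S → j ≡ i)

inExactlyOneCopy : (ℓ : ℕ) (S : VSet n) → IsSkelFace n ℓ S →
                   InExactlyOneCopy ℓ S (count (occupied S))
inExactlyOneCopy {n} ℓ S face = toFin c , inCopy , unique
  where
  k′ : ℕ
  k′ = count (occupied S)
  c : Choose n k′
  c = select (occupied S)
  inCopy : InCopy ℓ k′ n (embed (fromFin (toFin c))) S
  inCopy rewrite fromFin-toFin c = supportedOn⇒inCopy ℓ c S face (supportedOn-select S)
  unique : (j : Fin (C n k′)) → InCopy ℓ k′ n (embed (fromFin j)) S → j ≡ toFin c
  unique j S∈j = begin
    j                     ≡⟨ toFin-fromFin {n} j ⟨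
    toFin (fromFin {n} j) ≡⟨ cong toFin c≡j ⟨
    toFin c               ∎
    where
    open ≡-Reasoning
    c≡j : c ≡ fromFin j
    c≡j = ⊆⇒≡ c (fromFin j) (select⊆ S (fromFin j) (inCopy⇒supportedOn ℓ (fromFin j) S S∈j))

theorem1 : (ℓ n : ℕ) → 1 ≤ ℓ → ℓ < n → Factors ℓ n
theorem1 ℓ n _ _ =
  C n (suc ℓ) , (λ i → embed (fromFin i)) , (λ i → embed-isSkelEmbedding ℓ (fromFin i)) ,
  λ S (na , card≡) → subst (InExactlyOneCopy ℓ S) (trans (count-occupied S na) card≡)
                            (inExactlyOneCopy ℓ S (na , ≤-reflexive card≡))
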